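{- Let $K$ be a field of characteristic $0$ with an automorphism $\phi$, let $C=K^\phi$, let $q\in C^\times$, and let $K'=K(z)$ be a purely transcendental extension, with $\phi$ extended to $K'$ by $\phi(z)=qz$. Let $W$ be a $\phi$-module over $K$. Then $W$ is irreducible if and only if $W_{K'}=K'\otimes_K W$ (with $\Phi$ acting as $\phi\otimes\Phi$) is irreducible.
   Context: A $\phi$-module over a field $k$ with automorphism $\phi$ is a finite-dimensional $k$-vector space $W$ with a bijective additive map $\Phi:W\to W$ satisfying $\Phi(aw)=\phi(a)\Phi(w)$ for $a\in k$, $w\in W$. A $\phi$-submodule is a $\Phi$-stable $k$-subspace; $W$ is irreducible if its only $\phi$-submodules are $0$ and $W$. -}

module Defs where

open import Level using (Level) renaming (suc to lsuc)
open import Algebra.Bundles using (CommutativeRing)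
open import Algebra.Module.Bundles using (Module)
open import Data.Nat using (ℕ; zero; suc)
open import Data.Fin using (Fin; zero; suc)
open import Data.List using (List; []; _∷_; map; foldr)
open import Data.List.Relation.Unary.All using (All)
open import Data.Product using (Σ; _×_; _,_)
open import Data.Sum using (_⊎_)
open import Relation.Nullary using (¬_)
open import Relation.Unary using (Pred)
open import Function using (_∘_)

record Field (a : Level) : Set (lsuc a) where
  field
    commutativeRing : CommutativeRing a a
  open CommutativeRing commutativeRing public
  field
    1#≉0#   : ¬ (1# ≈ 0#)
    inverse : ∀ x → ¬ (x ≈ 0#) → Σ Carrier λ y → x * y ≈ 1#

module _ {a : Level} (K : Field a) where
  open Field K

  ℕ→K : ℕ → Carrier
  ℕ→K zero    = 0#
  ℕ→K (suc n) = 1# + ℕ→K n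

  CharZero : Set a
  CharZero = ∀ n → ¬ (ℕ→K (suc n) ≈ 0#)

record IsFieldHom {a : Level} (K L : Field a)
                  (f : Field.Carrier K → Field.Carrier L) : Set a where
  private
    module K = Field K
    module L = Field L
  field
    cong  : ∀ {x y} → x K.≈ y → f x L.≈ f y
    +-hom : ∀ x y → f (x K.+ y) L.≈ (f x L.+ f y)
    *-hom : ∀ x y → f (x K.* y) L.≈ (f x L.* f y)
    1-hom : f K.1# L.≈ L.1#

record IsAutomorphism {a : Level} (K : Field a)
                      (φ : Field.Carrier K → Field.Carrier K) : Set a where
  open Field K
  field
    isHom      : IsFieldHom K K φ
    injective  : ∀ x y → φ x ≈ φ y → x ≈ y
    surjective : ∀ y → Σ Carrier λ x → φ x ≈ y

-- Polynomials (coefficient lists, constant term first) and evaluation.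

module _ {a : Level} (L : Field a) where
  open Field L

  evalPoly : List Carrier → Carrier → Carrier
  evalPoly cs x = foldr (λ c acc → c + x * acc) 0# cs

-- L is a purely transcendental extension K(z) of K (via the embedding ι):
-- z is transcendental over K, and every element of L is a quotient
-- p(z)/r(z) of polynomials with coefficients in K.
record IsPurelyTranscendental {a : Level} (K L : Field a)
       (ι : Field.Carrier K → Field.Carrier L) (z : Field.Carrier L) : Set a where
  private
    module K = Field K
    module L = Field L
  field
    ι-hom          : IsFieldHom K L ι
    transcendental : ∀ (p : List K.Carrier) →
                     evalPoly L (map ι p) z L.≈ L.0# → All (λ c → c K.≈ K.0#) p
    generated      : ∀ (x : L.Carrier) →
                     Σ (List K.Carrier) λ p → Σ (List K.Carrier) λ r →
                       (¬ (evalPoly L (map ι r) z L.≈ L.0#)) ×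
                       ((x L.* evalPoly L (map ι r) z) L.≈ evalPoly L (map ι p) z)

VectorSpace : {a : Level} → Field a → Set (lsuc a)
VectorSpace {a} K = Module (Field.commutativeRing K) a a

module _ {a : Level} {K : Field a} (M : VectorSpace K) where
  open Field K using (Carrier; _≈_; 0#)
  open Module M using (Carrierᴹ; _≈ᴹ_; _+ᴹ_; _*ₗ_; 0ᴹ)

  ∑ : ∀ {n} → (Fin n → Carrierᴹ) → Carrierᴹ
  ∑ {zero}  v = 0ᴹ
  ∑ {suc n} v = v zero +ᴹ ∑ (v ∘ suc)

  record IsBasis {n : ℕ} (e : Fin n → Carrierᴹ) : Set a where
    field
      spanning    : ∀ w → Σ (Fin n → Carrier) λ c → w ≈ᴹ ∑ (λ i → c i *ₗ e i)
      independent : ∀ (c : Fin n → Carrier) →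
                    ∑ (λ i → c i *ₗ e i) ≈ᴹ 0ᴹ → ∀ i → c i ≈ 0#

  FiniteDimensional : Set a
  FiniteDimensional = Σ ℕ λ n → Σ (Fin n → Carrierᴹ) λ e → IsBasis e

record PhiModule {a : Level} (K : Field a)
                 (φ : Field.Carrier K → Field.Carrier K) : Set (lsuc a) where
  field
    space : VectorSpace K
  open Field K using (Carrier)
  open Module space using (Carrierᴹ; _≈ᴹ_; _+ᴹ_; _*ₗ_)
  field
    Φ            : Carrierᴹ → Carrierᴹ
    Φ-cong       : ∀ {v w} → v ≈ᴹ w → Φ v ≈ᴹ Φ w
    Φ-+          : ∀ v w → Φ (v +ᴹ w) ≈ᴹ (Φ v +ᴹ Φ w)
    Φ-semilinear : ∀ c w → Φ (c *ₗ w) ≈ᴹ (φ c *ₗ Φ w)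
    Φ-injective  : ∀ v w → Φ v ≈ᴹ Φ w → v ≈ᴹ w
    Φ-surjective : ∀ w → Σ Carrierᴹ λ v → Φ v ≈ᴹ w
    finiteDim    : FiniteDimensional {K = K} space

module _ {a : Level} {K : Field a} {φ : Field.Carrier K → Field.Carrier K}
         (W : PhiModule K φ) where
  open PhiModule W using (space; Φ)
  open Module space using (Carrierᴹ; _≈ᴹ_; _+ᴹ_; _*ₗ_; 0ᴹ)

  record IsPhiSubmodule (P : Pred Carrierᴹ a) : Set a where
    field
      resp  : ∀ {v w} → v ≈ᴹ w → P v → P w
      has0  : P 0ᴹ
      +-cl  : ∀ {v w} → P v → P w → P (v +ᴹ w)
      *ₗ-cl : ∀ c {w} → P w → P (c *ₗ w)
      Φ-cl  : ∀ {w} → P w → P (Φ w)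

  Irreducible : Set (lsuc a)
  Irreducible = ∀ (P : Pred Carrierᴹ a) → IsPhiSubmodule P →
                (∀ w → P w → w ≈ᴹ 0ᴹ) ⊎ (∀ w → P w)

-- V is the scalar extension L ⊗_K W, realised by a K-semilinear map
-- j : W → V (w ↦ 1 ⊗ w) sending every K-basis of W to an L-basis of V.

record IsBaseChange {a : Level} {K L : Field a}
       (ι : Field.Carrier K → Field.Carrier L)
       (W : VectorSpace K) (V : VectorSpace L)
       (j : Module.Carrierᴹ W → Module.Carrierᴹ V) : Set (lsuc a) where
  private
    module W = Module W
    module V = Module V
  field
    j-cong  : ∀ {v w} → v W.≈ᴹ w → j v V.≈ᴹ j w
    j-+     : ∀ v w → j (v W.+ᴹ w) V.≈ᴹ (j v V.+ᴹ j w)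
    j-*ₗ    : ∀ c w → j (c W.*ₗ w) V.≈ᴹ (ι c V.*ₗ j w)
    j-basis : ∀ n (e : Fin n → W.Carrierᴹ) → IsBasis {K = K} W e → IsBasis {K = L} V (j ∘ e)

-- Inside V = L ⊗ W lies W[z] = { Σ zᵏ j(gₖ) }. It is Φ-stable because Φ z = q z, every vector of V
-- has a nonzero polynomial multiple in W[z], and since z is transcendental the coefficients of an
-- element of W[z] are unique.
--
-- For a φ-submodule P of W, the vectors with a nonzero polynomial multiple in P[z] form a
-- φ-submodule of V meeting j(W) exactly in j(P) (compare lowest coefficients); so if V is
-- irreducible, P is 0 or W.
--
-- For a φ-submodule Q of V, the constant terms of the elements of Q ∩ W[z] form a φ-submodule R
-- of W. If R = 0 then Q = 0, by dividing out powers of z. If R = W, Q contains xᵢ ∈ W[z] with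
-- constant terms the basis vectors eᵢ; a polynomial relation among the xᵢ has constant terms
-- forming a relation among the eᵢ, so by induction on the degree the xᵢ are L-independent, hence
-- span V by counting dimensions, and Q = V.

{-# OPTIONS --safe #-}
module Submission where

open import Defs
open import Level using (Level)
open import Axiom.ExcludedMiddle using (ExcludedMiddle)
open import Algebra.Bundles using (CommutativeMonoid)
open import Algebra.Module.Bundles using (Module)
open import Algebra.Module.Construct.TensorUnit using (⟨module⟩)
open import Data.Nat using (ℕ; zero; suc)
open import Data.Fin using (Fin; zero; suc)
open import Data.List using (List; []; _∷_; map; length)
open import Data.Vec as Vec using (Vec; []; _∷_; toList)
open import Data.List.Relation.Unary.All using (All; []; _∷_; universal)
open import Data.Fin.Permutation using (Permutation′; _⟨$⟩ʳ_; _⟨$⟩ˡ_; inverseˡ; transpose)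
open import Data.Product using (Σ; ∃; _×_; _,_; proj₁; proj₂)
open import Data.Sum using (inj₁; inj₂)
open import Data.Empty using (⊥-elim)
open import Data.Unit.Polymorphic using (⊤; tt)
open import Function using (_∘_)
open import Function.Bundles using (_⇔_; mk⇔)
open import Relation.Nullary using (¬_; yes; no)
open import Relation.Unary using (Pred)
open import Relation.Binary.PropositionalEquality as ≡ using (_≡_)
import Relation.Binary.Reasoning.Setoid as SetoidReasoning
import Algebra.Properties.CommutativeMonoid.Sum as MonoidSum
import Algebra.Properties.Group as GroupProperties

module FieldProperties {a : Level} (F : Field a) where
  open Field F

  inv : ∀ x → ¬ (x ≈ 0#) → Carrier
  inv x x≉0 = proj₁ (inverse x x≉0)

  inv-inverseˡ : ∀ x (x≉0 : ¬ (x ≈ 0#)) → inv x x≉0 * x ≈ 1#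
  inv-inverseˡ x x≉0 = trans (*-comm _ _) (proj₂ (inverse x x≉0))

  x≉0∧x*y≈0⇒y≈0 : ∀ {x y} → ¬ (x ≈ 0#) → x * y ≈ 0# → y ≈ 0#
  x≉0∧x*y≈0⇒y≈0 {x} {y} x≉0 xy≈0 = begin
    y                      ≈⟨ *-identityˡ y ⟨
    1# * y                 ≈⟨ *-congʳ (inv-inverseˡ x x≉0) ⟨
    (inv x x≉0 * x) * y    ≈⟨ *-assoc _ _ _ ⟩
    inv x x≉0 * (x * y)    ≈⟨ *-congˡ xy≈0 ⟩
    inv x x≉0 * 0#         ≈⟨ zeroʳ _ ⟩
    0#                     ∎
    where
    open SetoidReasoning setoid

  x≉0∧y≉0⇒x*y≉0 : ∀ {x y} → ¬ (x ≈ 0#) → ¬ (y ≈ 0#) → ¬ (x * y ≈ 0#)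
  x≉0∧y≉0⇒x*y≉0 x≉0 y≉0 xy≈0 = y≉0 (x≉0∧x*y≈0⇒y≈0 x≉0 xy≈0)

record IsSubspace {a : Level} {F : Field a} (M : VectorSpace F) (P : Pred (Module.Carrierᴹ M) a) : Set a where
  open Module M
  field
    resp  : ∀ {v w} → v ≈ᴹ w → P v → P w
    has0  : P 0ᴹ
    +-cl  : ∀ {v w} → P v → P w → P (v +ᴹ w)
    *ₗ-cl : ∀ c {w} → P w → P (c *ₗ w)

module VectorSpaceProperties {a : Level} {F : Field a} (M : VectorSpace F) where
  open Field F using (Carrier; _≈_; _*_; _+_; 0#; 1#; -_)
  open Module M
  open FieldProperties F
  open SetoidReasoning ≈ᴹ-setoid
  open GroupProperties +ᴹ-group public
    using (identityˡ-unique; inverseˡ-unique; ∙-cancelˡ)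

  private module Sum = MonoidSum +ᴹ-commutativeMonoid

  ∑ᴹ : ∀ {n} → (Fin n → Carrierᴹ) → Carrierᴹ
  ∑ᴹ = ∑ {K = F} M

  ∑ᶠ : ∀ {n} → (Fin n → Carrier) → Carrier
  ∑ᶠ = ∑ {K = F} ⟨module⟩

  x+x≈x⇒x≈0 : ∀ {x} → x +ᴹ x ≈ᴹ x → x ≈ᴹ 0ᴹ
  x+x≈x⇒x≈0 {x} = identityˡ-unique x x

  inv-*ₗ-cancel : ∀ {c} (c≉0 : ¬ (c ≈ 0#)) v → inv c c≉0 *ₗ (c *ₗ v) ≈ᴹ v
  inv-*ₗ-cancel {c} c≉0 v = begin
    inv c c≉0 *ₗ (c *ₗ v)   ≈⟨ *ₗ-assoc _ _ _ ⟨
    (inv c c≉0 * c) *ₗ v    ≈⟨ *ₗ-congʳ (inv-inverseˡ c c≉0) ⟩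
    1# *ₗ v                 ≈⟨ *ₗ-identityˡ v ⟩
    v                       ∎

  *ₗ-cancelˡ : ∀ {c v w} → ¬ (c ≈ 0#) → c *ₗ v ≈ᴹ c *ₗ w → v ≈ᴹ w
  *ₗ-cancelˡ {c} {v} {w} c≉0 cv≈cw = begin
    v                        ≈⟨ inv-*ₗ-cancel c≉0 v ⟨
    inv c c≉0 *ₗ (c *ₗ v)    ≈⟨ *ₗ-congˡ cv≈cw ⟩
    inv c c≉0 *ₗ (c *ₗ w)    ≈⟨ inv-*ₗ-cancel c≉0 w ⟩
    w                        ∎

  c≉0∧c*v≈0⇒v≈0 : ∀ {c v} → ¬ (c ≈ 0#) → c *ₗ v ≈ᴹ 0ᴹ → v ≈ᴹ 0ᴹ
  c≉0∧c*v≈0⇒v≈0 c≉0 cv≈0 = *ₗ-cancelˡ c≉0 (≈ᴹ-trans cv≈0 (≈ᴹ-sym (*ₗ-zeroʳ _)))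

  ∑-cong : ∀ {n} {f g : Fin n → Carrierᴹ} → (∀ i → f i ≈ᴹ g i) → ∑ᴹ f ≈ᴹ ∑ᴹ g
  ∑-cong {zero}  f≈g = ≈ᴹ-refl
  ∑-cong {suc n} f≈g = +ᴹ-cong (f≈g zero) (∑-cong (f≈g ∘ suc))

  ∑-zero : ∀ {n} {f : Fin n → Carrierᴹ} → (∀ i → f i ≈ᴹ 0ᴹ) → ∑ᴹ f ≈ᴹ 0ᴹ
  ∑-zero {zero}  f≈0 = ≈ᴹ-refl
  ∑-zero {suc n} f≈0 = ≈ᴹ-trans (+ᴹ-cong (f≈0 zero) (∑-zero (f≈0 ∘ suc))) (+ᴹ-identityˡ 0ᴹ)

  private
    ∑≡sum : ∀ {n} (f : Fin n → Carrierᴹ) → ∑ᴹ f ≡ Sum.sum f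
    ∑≡sum {zero}  f = ≡.refl
    ∑≡sum {suc n} f = ≡.cong (f zero +ᴹ_) (∑≡sum (f ∘ suc))

  ∑-distrib-+ : ∀ {n} (f g : Fin n → Carrierᴹ) → ∑ᴹ (λ i → f i +ᴹ g i) ≈ᴹ ∑ᴹ f +ᴹ ∑ᴹ g
  ∑-distrib-+ f g = begin
    ∑ᴹ (λ i → f i +ᴹ g i)      ≡⟨ ∑≡sum (λ i → f i +ᴹ g i) ⟩
    Sum.sum (λ i → f i +ᴹ g i) ≈⟨ Sum.∑-distrib-+ f g ⟩
    Sum.sum f +ᴹ Sum.sum g     ≡⟨ ≡.cong₂ _+ᴹ_ (∑≡sum f) (∑≡sum g) ⟨
    ∑ᴹ f +ᴹ ∑ᴹ g               ∎

  ∑-permute : ∀ {n} (f : Fin n → Carrierᴹ) (π : Permutation′ n) → ∑ᴹ f ≈ᴹ ∑ᴹ (f ∘ (π ⟨$⟩ʳ_))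
  ∑-permute f π = begin
    ∑ᴹ f                       ≡⟨ ∑≡sum f ⟩
    Sum.sum f                  ≈⟨ Sum.∑-permute f π ⟩
    Sum.sum (f ∘ (π ⟨$⟩ʳ_))    ≡⟨ ∑≡sum (f ∘ (π ⟨$⟩ʳ_)) ⟨
    ∑ᴹ (f ∘ (π ⟨$⟩ʳ_))         ∎

  ∑-comm : ∀ {m n} (f : Fin m → Fin n → Carrierᴹ) →
           ∑ᴹ (λ i → ∑ᴹ (f i)) ≈ᴹ ∑ᴹ (λ k → ∑ᴹ (λ i → f i k))
  ∑-comm {zero} {n} f = ≈ᴹ-sym (∑-zero {n} (λ _ → ≈ᴹ-refl))
  ∑-comm {suc m} f = ≈ᴹ-trans (+ᴹ-congˡ (∑-comm (f ∘ suc)))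
                              (≈ᴹ-sym (∑-distrib-+ (f zero) (λ k → ∑ᴹ (λ i → f (suc i) k))))

  *ₗ-distrib-∑ : ∀ {n} c (f : Fin n → Carrierᴹ) → c *ₗ ∑ᴹ f ≈ᴹ ∑ᴹ (λ i → c *ₗ f i)
  *ₗ-distrib-∑ {zero}  c f = *ₗ-zeroʳ c
  *ₗ-distrib-∑ {suc n} c f = ≈ᴹ-trans (*ₗ-distribˡ c _ _) (+ᴹ-congˡ (*ₗ-distrib-∑ c (f ∘ suc)))

  ∑-*ₗ-distribʳ : ∀ {n} (c : Fin n → Carrier) v → ∑ᴹ (λ i → c i *ₗ v) ≈ᴹ ∑ᶠ c *ₗ v
  ∑-*ₗ-distribʳ {zero}  c v = ≈ᴹ-sym (*ₗ-zeroˡ v)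
  ∑-*ₗ-distribʳ {suc n} c v = ≈ᴹ-trans (+ᴹ-congˡ (∑-*ₗ-distribʳ (c ∘ suc) v)) (≈ᴹ-sym (*ₗ-distribʳ v _ _))

  -1*ₗv≈-v : ∀ v → (- 1#) *ₗ v ≈ᴹ -ᴹ v
  -1*ₗv≈-v v = inverseˡ-unique _ v (begin
    (- 1#) *ₗ v +ᴹ v          ≈⟨ +ᴹ-congˡ (*ₗ-identityˡ v) ⟨
    (- 1#) *ₗ v +ᴹ 1# *ₗ v    ≈⟨ *ₗ-distribʳ v _ _ ⟨
    ((- 1#) + 1#) *ₗ v        ≈⟨ *ₗ-congʳ (Field.-‿inverseˡ F 1#) ⟩
    0# *ₗ v                   ≈⟨ *ₗ-zeroˡ v ⟩
    0ᴹ                        ∎)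

  LinearlyIndependent : ∀ {n} → (Fin n → Carrierᴹ) → Set a
  LinearlyIndependent {n} x = ∀ (c : Fin n → Carrier) → ∑ᴹ (λ i → c i *ₗ x i) ≈ᴹ 0ᴹ → ∀ i → c i ≈ 0#

  Spans : ∀ {n} → (Fin n → Carrierᴹ) → Set a
  Spans {n} e = ∀ w → Σ (Fin n → Carrier) λ c → w ≈ᴹ ∑ᴹ (λ i → c i *ₗ e i)

  module _ {P : Pred Carrierᴹ a} (P-subspace : IsSubspace {F = F} M P) where
    open IsSubspace P-subspace

    ∑-closed : ∀ {n} (f : Fin n → Carrierᴹ) → (∀ i → P (f i)) → P (∑ᴹ f)
    ∑-closed {zero}  f Pf = has0
    ∑-closed {suc n} f Pf = +-cl (Pf zero) (∑-closed (f ∘ suc) (Pf ∘ suc))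

    combination-closed : ∀ {n} (c : Fin n → Carrier) {x : Fin n → Carrierᴹ} →
                         (∀ i → P (x i)) → P (∑ᴹ (λ i → c i *ₗ x i))
    combination-closed c Px = ∑-closed _ (λ i → *ₗ-cl (c i) (Px i))

    spans⇒full : ∀ {n} {e : Fin n → Carrierᴹ} → Spans e → (∀ i → P (e i)) → ∀ v → P v
    spans⇒full spans Pe v = resp (≈ᴹ-sym (proj₂ (spans v))) (combination-closed _ Pe)

  module Coordinates {n} {e : Fin n → Carrierᴹ} (basis : IsBasis {K = F} M e) where
    open IsBasis basis

    coord : Carrierᴹ → Fin n → Carrier
    coord w = proj₁ (spanning w)

    coord-spec : ∀ w → w ≈ᴹ ∑ᴹ (λ i → coord w i *ₗ e i)
    coord-spec w = proj₂ (spanning w)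

    coordinates-unique : ∀ (c d : Fin n → Carrier) →
                         ∑ᴹ (λ i → c i *ₗ e i) ≈ᴹ ∑ᴹ (λ i → d i *ₗ e i) → ∀ i → c i ≈ d i
    coordinates-unique c d c≈d i =
      F.x∙y⁻¹≈ε⇒x≈y (c i) (d i) (independent (λ i → c i - d i) difference≈0 i)
      where
      module F = GroupProperties (Field.+-group F)
      _-_ : Carrier → Carrier → Carrier
      x - y = x + - y
      difference≈0 : ∑ᴹ (λ i → (c i - d i) *ₗ e i) ≈ᴹ 0ᴹ
      difference≈0 = identityˡ-unique _ (∑ᴹ (λ i → d i *ₗ e i)) (begin
        ∑ᴹ (λ i → (c i - d i) *ₗ e i) +ᴹ ∑ᴹ (λ i → d i *ₗ e i)
          ≈⟨ ∑-distrib-+ {n} _ _ ⟨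
        ∑ᴹ (λ i → (c i - d i) *ₗ e i +ᴹ d i *ₗ e i)
          ≈⟨ ∑-cong (λ i → ≈ᴹ-trans (≈ᴹ-sym (*ₗ-distribʳ (e i) _ _)) (*ₗ-congʳ (F.//-rightDividesˡ (d i) (c i)))) ⟩
        ∑ᴹ (λ i → c i *ₗ e i)
          ≈⟨ c≈d ⟩
        ∑ᴹ (λ i → d i *ₗ e i) ∎)

module RowDependence {a : Level} (em : ExcludedMiddle a) (F : Field a) where
  open Field F hiding (zero)
  open VectorSpaceProperties {F = F} ⟨module⟩
    using (∑ᶠ; ∑-cong; ∑-zero; ∑-distrib-+; ∑-permute; ∑-*ₗ-distribʳ)
  open SetoidReasoning setoid
  open import Algebra.Properties.Ring ring using (-‿distribˡ-*)

  RowsDependent : ∀ {m n} → (Fin m → Fin n → Carrier) → Set a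
  RowsDependent {m} A = Σ (Fin m → Carrier) λ c → (∃ λ i → ¬ (c i ≈ 0#)) ×
                            (∀ k → ∑ᶠ (λ i → c i * A i k) ≈ 0#)

  dependent-permute : ∀ {m n} (π : Permutation′ m) (A : Fin m → Fin n → Carrier) →
                      RowsDependent (A ∘ (π ⟨$⟩ʳ_)) → RowsDependent A
  dependent-permute {m} π A (c , (i , cᵢ≉0) , relation) =
    c ∘ (π ⟨$⟩ˡ_) , (π ⟨$⟩ʳ i , c-πᵢ≉0) , relation′
    where
    c-πᵢ≉0 : ¬ (c (π ⟨$⟩ˡ (π ⟨$⟩ʳ i)) ≈ 0#)
    c-πᵢ≉0 rewrite inverseˡ π {i} = cᵢ≉0
    relation′ : ∀ k → ∑ᶠ (λ i → c (π ⟨$⟩ˡ i) * A i k) ≈ 0#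
    relation′ k = begin
      ∑ᶠ (λ i → c (π ⟨$⟩ˡ i) * A i k)
        ≈⟨ ∑-permute (λ i → c (π ⟨$⟩ˡ i) * A i k) π ⟩
      ∑ᶠ (λ i → c (π ⟨$⟩ˡ (π ⟨$⟩ʳ i)) * A (π ⟨$⟩ʳ i) k)
        ≈⟨ ∑-cong {m} (λ i → reflexive (≡.cong (λ j → c j * A (π ⟨$⟩ʳ i) k) (inverseˡ π))) ⟩
      ∑ᶠ (λ i → c i * A (π ⟨$⟩ʳ i) k)
        ≈⟨ relation k ⟩
      0# ∎

  dependent-tail : ∀ {m n} (A : Fin (suc m) → Fin n → Carrier) →
                   RowsDependent (A ∘ suc) → RowsDependent A
  dependent-tail A (c , (i , cᵢ≉0) , relation) = c′ , (suc i , cᵢ≉0) , relation′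
    where
    c′ : Fin _ → Carrier
    c′ zero    = 0#
    c′ (suc i) = c i
    relation′ : ∀ k → ∑ᶠ (λ i → c′ i * A i k) ≈ 0#
    relation′ k = trans (+-cong (zeroˡ _) (relation k)) (+-identityˡ 0#)

  dependent-zeroColumn : ∀ {m n} (A : Fin m → Fin (suc n) → Carrier) → (∀ i → A i zero ≈ 0#) →
                         RowsDependent (λ i k → A i (suc k)) → RowsDependent A
  dependent-zeroColumn {m} A column≈0 (c , nontrivial , relation) = c , nontrivial , relation′
    where
    relation′ : ∀ k → ∑ᶠ (λ i → c i * A i k) ≈ 0#
    relation′ zero    = ∑-zero {m} (λ i → trans (*-congˡ (column≈0 i)) (zeroʳ (c i)))
    relation′ (suc k) = relation k

  -- Row i + 1 minus (A (i + 1) 0 / p) times row 0, scaled by the pivot p = A 0 0 to avoid division.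
  eliminate : ∀ {m n} → (Fin (suc m) → Fin (suc n) → Carrier) → Fin m → Fin (suc n) → Carrier
  eliminate A i k = A zero zero * A (suc i) k + (- A (suc i) zero) * A zero k

  dependent-pivot : ∀ {m n} (A : Fin (suc m) → Fin (suc n) → Carrier) → ¬ (A zero zero ≈ 0#) →
                    RowsDependent (λ i k → eliminate A i (suc k)) → RowsDependent A
  dependent-pivot {m} A p≉0 (d , (i , dᵢ≉0) , relation) =
    c , (suc i , x≉0∧y≉0⇒x*y≉0 dᵢ≉0 p≉0) , relation′
    where
    open FieldProperties F using (x≉0∧y≉0⇒x*y≉0)
    p : Carrier
    p = A zero zero
    c : Fin (suc m) → Carrier
    c zero    = ∑ᶠ (λ i → d i * - A (suc i) zero)
    c (suc i) = d i * p
    regroup : ∀ d b y x → (d * b) * y + (d * p) * x ≈ d * (p * x + b * y)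
    regroup d b y x = begin
      (d * b) * y + (d * p) * x   ≈⟨ +-cong (*-assoc d b y) (*-assoc d p x) ⟩
      d * (b * y) + d * (p * x)   ≈⟨ distribˡ d _ _ ⟨
      d * (b * y + p * x)         ≈⟨ *-congˡ (+-comm _ _) ⟩
      d * (p * x + b * y)         ∎
    combination : ∀ k → ∑ᶠ (λ i → c i * A i k) ≈ ∑ᶠ (λ i → d i * eliminate A i k)
    combination k = begin
      ∑ᶠ (λ i → d i * - A (suc i) zero) * A zero k + ∑ᶠ (λ i → (d i * p) * A (suc i) k)
        ≈⟨ +-congʳ (∑-*ₗ-distribʳ {m} _ _) ⟨
      ∑ᶠ (λ i → (d i * - A (suc i) zero) * A zero k) + ∑ᶠ (λ i → (d i * p) * A (suc i) k)
        ≈⟨ ∑-distrib-+ {m} _ _ ⟨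
      ∑ᶠ (λ i → (d i * - A (suc i) zero) * A zero k + (d i * p) * A (suc i) k)
        ≈⟨ ∑-cong {m} (λ i → regroup (d i) (- A (suc i) zero) (A zero k) (A (suc i) k)) ⟩
      ∑ᶠ (λ i → d i * eliminate A i k) ∎
    eliminated-column≈0 : ∀ i → eliminate A i zero ≈ 0#
    eliminated-column≈0 i =
      trans (+-congˡ (trans (sym (-‿distribˡ-* _ _)) (-‿cong (*-comm _ _)))) (-‿inverseʳ _)
    relation′ : ∀ k → ∑ᶠ (λ i → c i * A i k) ≈ 0#
    relation′ zero    = trans (combination zero)
                              (∑-zero {m} (λ i → trans (*-congˡ (eliminated-column≈0 i)) (zeroʳ (d i))))
    relation′ (suc k) = trans (combination (suc k)) (relation k)

  rowsDependent : ∀ n (A : Fin (suc n) → Fin n → Carrier) → RowsDependent A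
  rowsDependent zero    A = (λ _ → 1#) , (zero , 1#≉0#) , λ ()
  rowsDependent (suc n) A with em {∃ λ i → ¬ (A i zero ≈ 0#)}
  ... | yes (i , Aᵢ₀≉0) =
    dependent-permute π A (dependent-pivot A′ Aᵢ₀≉0 (rowsDependent n (λ i k → eliminate A′ i (suc k))))
    where
    π : Permutation′ (suc (suc n))
    π = transpose zero i
    A′ : Fin (suc (suc n)) → Fin (suc n) → Carrier
    A′ = A ∘ (π ⟨$⟩ʳ_)
  ... | no ¬∃ = dependent-zeroColumn A column≈0
                  (dependent-tail (λ i k → A i (suc k)) (rowsDependent n (λ i k → A (suc i) (suc k))))
    where
    column≈0 : ∀ i → A i zero ≈ 0#
    column≈0 i with em {A i zero ≈ 0#}
    ... | yes Aᵢ₀≈0 = Aᵢ₀≈0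
    ... | no  Aᵢ₀≉0 = ⊥-elim (¬∃ (i , Aᵢ₀≉0))

module Dimension {a : Level} (em : ExcludedMiddle a) {F : Field a} (M : VectorSpace F) where
  open Field F using (Carrier; _≈_; _*_; 0#; 1#; -_)
  open Module M
  open VectorSpaceProperties {F = F} M
  open FieldProperties F using (inv)
  open RowDependence em F using (rowsDependent)
  open SetoidReasoning ≈ᴹ-setoid

  ∑-*ₗ-∑ : ∀ {m n} (c : Fin m → Carrier) (A : Fin m → Fin n → Carrier) (e : Fin n → Carrierᴹ) →
           ∑ᴹ (λ i → c i *ₗ ∑ᴹ (λ k → A i k *ₗ e k)) ≈ᴹ ∑ᴹ (λ k → ∑ᶠ (λ i → c i * A i k) *ₗ e k)
  ∑-*ₗ-∑ {m} {n} c A e = begin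
    ∑ᴹ (λ i → c i *ₗ ∑ᴹ (λ k → A i k *ₗ e k))
      ≈⟨ ∑-cong {m} (λ i → ≈ᴹ-trans (*ₗ-distrib-∑ (c i) (λ k → A i k *ₗ e k))
                                    (∑-cong {n} (λ k → ≈ᴹ-sym (*ₗ-assoc _ _ _)))) ⟩
    ∑ᴹ (λ i → ∑ᴹ (λ k → (c i * A i k) *ₗ e k))
      ≈⟨ ∑-comm (λ i k → (c i * A i k) *ₗ e k) ⟩
    ∑ᴹ (λ k → ∑ᴹ (λ i → (c i * A i k) *ₗ e k))
      ≈⟨ ∑-cong {n} (λ k → ∑-*ₗ-distribʳ (λ i → c i * A i k) (e k)) ⟩
    ∑ᴹ (λ k → ∑ᶠ (λ i → c i * A i k) *ₗ e k) ∎

  spans⇒dependent : ∀ {n} {e : Fin n → Carrierᴹ} → Spans e → (y : Fin (suc n) → Carrierᴹ) →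
                    Σ (Fin (suc n) → Carrier) λ c → (∃ λ i → ¬ (c i ≈ 0#)) ×
                    ∑ᴹ (λ i → c i *ₗ y i) ≈ᴹ 0ᴹ
  spans⇒dependent {n} {e} spans y with rowsDependent n (λ i → proj₁ (spans (y i)))
  ... | c , nontrivial , relation = c , nontrivial , (begin
    ∑ᴹ (λ i → c i *ₗ y i)
      ≈⟨ ∑-cong {f = λ i → c i *ₗ y i} (λ i → *ₗ-congˡ (proj₂ (spans (y i)))) ⟩
    ∑ᴹ (λ i → c i *ₗ ∑ᴹ (λ k → A i k *ₗ e k))
      ≈⟨ ∑-*ₗ-∑ c A e ⟩
    ∑ᴹ (λ k → ∑ᶠ (λ i → c i * A i k) *ₗ e k)
      ≈⟨ ∑-zero {n} (λ k → ≈ᴹ-trans (*ₗ-congʳ (relation k)) (*ₗ-zeroˡ (e k))) ⟩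
    0ᴹ ∎)
    where
    A : Fin (suc n) → Fin n → Carrier
    A i = proj₁ (spans (y i))

  independent⇒spans : ∀ {n} {e x : Fin n → Carrierᴹ} → Spans e → LinearlyIndependent x → Spans x
  independent⇒spans {n} {e} {x} spans independent v with spans⇒dependent spans y
    where
    y : Fin (suc n) → Carrierᴹ
    y zero    = v
    y (suc i) = x i
  ... | c , (i₀ , cᵢ₀≉0) , c₀v+S≈0 with em {c zero ≈ 0#}
  ...   | yes c₀≈0 = ⊥-elim (cᵢ₀≉0 (all-zero i₀))
    where
    S≈0 : ∑ᴹ (λ i → c (suc i) *ₗ x i) ≈ᴹ 0ᴹ
    S≈0 = ≈ᴹ-trans (≈ᴹ-sym (+ᴹ-identityˡ _))
                   (≈ᴹ-trans (+ᴹ-congʳ (≈ᴹ-sym (≈ᴹ-trans (*ₗ-congʳ c₀≈0) (*ₗ-zeroˡ v)))) c₀v+S≈0)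
    all-zero : ∀ i → c i ≈ 0#
    all-zero zero    = c₀≈0
    all-zero (suc i) = independent (c ∘ suc) S≈0 i
  ...   | no c₀≉0 = d , (begin
    v                                                ≈⟨ inv-*ₗ-cancel c₀≉0 v ⟨
    inv c₀ c₀≉0 *ₗ (c₀ *ₗ v)                          ≈⟨ *ₗ-congˡ (inverseˡ-unique _ _ c₀v+S≈0) ⟩
    inv c₀ c₀≉0 *ₗ (-ᴹ S)                             ≈⟨ *ₗ-congˡ (-1*ₗv≈-v S) ⟨
    inv c₀ c₀≉0 *ₗ ((- 1#) *ₗ S)                       ≈⟨ *ₗ-assoc _ _ _ ⟨
    (inv c₀ c₀≉0 * - 1#) *ₗ S                          ≈⟨ *ₗ-distrib-∑ {n} _ _ ⟩
    ∑ᴹ (λ i → (inv c₀ c₀≉0 * - 1#) *ₗ (c (suc i) *ₗ x i)) ≈⟨ ∑-cong {n} (λ i → *ₗ-assoc _ _ _) ⟨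
    ∑ᴹ (λ i → d i *ₗ x i)                             ∎)
    where
    c₀ : Carrier
    c₀ = c zero
    S : Carrierᴹ
    S = ∑ᴹ (λ i → c (suc i) *ₗ x i)
    d : Fin n → Carrier
    d i = (inv c₀ c₀≉0 * - 1#) * c (suc i)

record IsSemilinear {a : Level} {K L : Field a} (ι : Field.Carrier K → Field.Carrier L)
                    (W : VectorSpace K) (V : VectorSpace L)
                    (j : Module.Carrierᴹ W → Module.Carrierᴹ V) : Set a where
  private
    module W = Module W
    module V = Module V
  field
    cong   : ∀ {v w} → v W.≈ᴹ w → j v V.≈ᴹ j w
    +-hom  : ∀ v w → j (v W.+ᴹ w) V.≈ᴹ j v V.+ᴹ j w
    *ₗ-hom : ∀ c w → j (c W.*ₗ w) V.≈ᴹ ι c V.*ₗ j w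

  0-hom : j W.0ᴹ V.≈ᴹ V.0ᴹ
  0-hom = VectorSpaceProperties.x+x≈x⇒x≈0 {F = L} V
            (V.≈ᴹ-trans (V.≈ᴹ-sym (+-hom W.0ᴹ W.0ᴹ)) (cong (W.+ᴹ-identityˡ W.0ᴹ)))

  -ᴹ-hom : ∀ w → j (W.-ᴹ w) V.≈ᴹ V.-ᴹ j w
  -ᴹ-hom w = VectorSpaceProperties.inverseˡ-unique {F = L} V _ _
               (V.≈ᴹ-trans (V.≈ᴹ-sym (+-hom _ w)) (V.≈ᴹ-trans (cong (W.-ᴹ‿inverseˡ w)) 0-hom))

  ∑-hom : ∀ {n} (f : Fin n → W.Carrierᴹ) → j (∑ {K = K} W f) V.≈ᴹ ∑ {K = L} V (j ∘ f)
  ∑-hom {zero}  f = 0-hom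
  ∑-hom {suc n} f = V.≈ᴹ-trans (+-hom _ _) (V.+ᴹ-congˡ (∑-hom (f ∘ suc)))

fieldHom⇒semilinear : ∀ {a} {K L : Field a} {ι} → IsFieldHom K L ι →
                      IsSemilinear {K = K} {L = L} ι ⟨module⟩ ⟨module⟩ ι
fieldHom⇒semilinear ι-hom = record
  { cong = IsFieldHom.cong ι-hom ; +-hom = IsFieldHom.+-hom ι-hom ; *ₗ-hom = IsFieldHom.*-hom ι-hom }

record IsKzSubmodule {a : Level} {K L : Field a} (ι : Field.Carrier K → Field.Carrier L)
                     (z : Field.Carrier L) (M : VectorSpace L) (X : Pred (Module.Carrierᴹ M) a) : Set a where
  open Module M
  field
    resp    : ∀ {v w} → v ≈ᴹ w → X v → X w
    has0    : X 0ᴹ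
    +-cl    : ∀ {v w} → X v → X w → X (v +ᴹ w)
    ι-*ₗ-cl : ∀ c {v} → X v → X (ι c *ₗ v)
    z-*ₗ-cl : ∀ {v} → X v → X (z *ₗ v)

module Horner {a : Level} {K L : Field a} {ι : Field.Carrier K → Field.Carrier L}
              (z : Field.Carrier L) {W : VectorSpace K} {V : VectorSpace L}
              {j : Module.Carrierᴹ W → Module.Carrierᴹ V} (j-semilinear : IsSemilinear {K = K} {L = L} ι W V j) where
  private
    module K = Field K
    module W = Module W
    module J = IsSemilinear j-semilinear
  open Field L using (_*_)
  open Module V
  open SetoidReasoning ≈ᴹ-setoid

  ⟦_⟧ : List W.Carrierᴹ → Carrierᴹ
  ⟦ []     ⟧ = 0ᴹ
  ⟦ g ∷ gs ⟧ = j g +ᴹ z *ₗ ⟦ gs ⟧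

  infixl 6 _⊕_
  _⊕_ : List W.Carrierᴹ → List W.Carrierᴹ → List W.Carrierᴹ
  []       ⊕ hs       = hs
  (g ∷ gs) ⊕ []       = g ∷ gs
  (g ∷ gs) ⊕ (h ∷ hs) = (g W.+ᴹ h) ∷ (gs ⊕ hs)

  ⟦⊕⟧ : ∀ gs hs → ⟦ gs ⊕ hs ⟧ ≈ᴹ ⟦ gs ⟧ +ᴹ ⟦ hs ⟧
  ⟦⊕⟧ []       hs       = ≈ᴹ-sym (+ᴹ-identityˡ _)
  ⟦⊕⟧ (g ∷ gs) []       = ≈ᴹ-sym (+ᴹ-identityʳ _)
  ⟦⊕⟧ (g ∷ gs) (h ∷ hs) = begin
    j (g W.+ᴹ h) +ᴹ z *ₗ ⟦ gs ⊕ hs ⟧                   ≈⟨ +ᴹ-cong (J.+-hom g h) (*ₗ-congˡ (⟦⊕⟧ gs hs)) ⟩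
    (j g +ᴹ j h) +ᴹ z *ₗ (⟦ gs ⟧ +ᴹ ⟦ hs ⟧)            ≈⟨ +ᴹ-congˡ (*ₗ-distribˡ z _ _) ⟩
    (j g +ᴹ j h) +ᴹ (z *ₗ ⟦ gs ⟧ +ᴹ z *ₗ ⟦ hs ⟧)       ≈⟨ interchange _ _ _ _ ⟩
    (j g +ᴹ z *ₗ ⟦ gs ⟧) +ᴹ (j h +ᴹ z *ₗ ⟦ hs ⟧)       ∎
    where
    open import Algebra.Properties.CommutativeSemigroup
      (CommutativeMonoid.commutativeSemigroup +ᴹ-commutativeMonoid) using (interchange)

  ⟦map-*ₗ⟧ : ∀ c gs → ⟦ map (c W.*ₗ_) gs ⟧ ≈ᴹ ι c *ₗ ⟦ gs ⟧
  ⟦map-*ₗ⟧ c []       = ≈ᴹ-sym (*ₗ-zeroʳ _)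
  ⟦map-*ₗ⟧ c (g ∷ gs) = begin
    j (c W.*ₗ g) +ᴹ z *ₗ ⟦ map (c W.*ₗ_) gs ⟧   ≈⟨ +ᴹ-cong (J.*ₗ-hom c g) (*ₗ-congˡ (⟦map-*ₗ⟧ c gs)) ⟩
    ι c *ₗ j g +ᴹ z *ₗ (ι c *ₗ ⟦ gs ⟧)           ≈⟨ +ᴹ-congˡ (*ₗ-comm z (ι c) _) ⟩
    ι c *ₗ j g +ᴹ ι c *ₗ (z *ₗ ⟦ gs ⟧)           ≈⟨ *ₗ-distribˡ (ι c) _ _ ⟨
    ι c *ₗ (j g +ᴹ z *ₗ ⟦ gs ⟧)                  ∎

  ⟦0∷⟧ : ∀ gs → ⟦ W.0ᴹ ∷ gs ⟧ ≈ᴹ z *ₗ ⟦ gs ⟧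
  ⟦0∷⟧ gs = ≈ᴹ-trans (+ᴹ-congʳ J.0-hom) (+ᴹ-identityˡ _)

  IsPolynomialIn : Pred W.Carrierᴹ a → Pred Carrierᴹ a
  IsPolynomialIn P x = Σ (List W.Carrierᴹ) λ gs → All P gs × x ≈ᴹ ⟦ gs ⟧

  IsPolynomial : Pred Carrierᴹ a
  IsPolynomial = IsPolynomialIn (λ _ → ⊤)

  ⟦⟧-isPolynomial : ∀ gs → IsPolynomial ⟦ gs ⟧
  ⟦⟧-isPolynomial gs = gs , universal (λ _ → tt) gs , ≈ᴹ-refl

  module _ {P : Pred W.Carrierᴹ a} (P-subspace : IsSubspace {F = K} W P) where
    private module P = IsSubspace P-subspace

    All-⊕ : ∀ {gs hs} → All P gs → All P hs → All P (gs ⊕ hs)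
    All-⊕ []           Phs          = Phs
    All-⊕ (Pg ∷ Pgs)   []           = Pg ∷ Pgs
    All-⊕ (Pg ∷ Pgs)   (Ph ∷ Phs)   = P.+-cl Pg Ph ∷ All-⊕ Pgs Phs

    All-map-*ₗ : ∀ c {gs} → All P gs → All P (map (c W.*ₗ_) gs)
    All-map-*ₗ c []         = []
    All-map-*ₗ c (Pg ∷ Pgs) = P.*ₗ-cl c Pg ∷ All-map-*ₗ c Pgs

    polynomialIn-isKzSubmodule : IsKzSubmodule {K = K} {L = L} ι z V (IsPolynomialIn P)
    polynomialIn-isKzSubmodule = record
      { resp    = λ v≈w (gs , Pgs , v≈) → gs , Pgs , ≈ᴹ-trans (≈ᴹ-sym v≈w) v≈
      ; has0    = [] , [] , ≈ᴹ-refl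
      ; +-cl    = λ (gs , Pgs , v≈) (hs , Phs , w≈) →
                    gs ⊕ hs , All-⊕ Pgs Phs , ≈ᴹ-trans (+ᴹ-cong v≈ w≈) (≈ᴹ-sym (⟦⊕⟧ gs hs))
      ; ι-*ₗ-cl = λ c (gs , Pgs , v≈) →
                    map (c W.*ₗ_) gs , All-map-*ₗ c Pgs , ≈ᴹ-trans (*ₗ-congˡ v≈) (≈ᴹ-sym (⟦map-*ₗ⟧ c gs))
      ; z-*ₗ-cl = λ (gs , Pgs , v≈) →
                    W.0ᴹ ∷ gs , P.has0 ∷ Pgs , ≈ᴹ-trans (*ₗ-congˡ v≈) (≈ᴹ-sym (⟦0∷⟧ gs))
      }

  -- Φ (Σ zᵏ j gₖ) = Σ zᵏ j (qᵏ Φ gₖ), because Φ z = q z.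
  module Twist {φ′ : Field.Carrier L → Field.Carrier L}
               {Φᵂ : W.Carrierᴹ → W.Carrierᴹ} {Φⱽ : Carrierᴹ → Carrierᴹ}
               (Φⱽ-semilinear : IsSemilinear {K = L} {L = L} φ′ V V Φⱽ) (Φ-commutes : ∀ w → Φⱽ (j w) ≈ᴹ j (Φᵂ w))
               (q : K.Carrier) (φ′z : Field._≈_ L (φ′ z) (ι q * z)) where
    private module Φ = IsSemilinear Φⱽ-semilinear

    twist : List W.Carrierᴹ → List W.Carrierᴹ
    twist []       = []
    twist (g ∷ gs) = Φᵂ g ∷ map (q W.*ₗ_) (twist gs)

    Φ⟦⟧ : ∀ gs → Φⱽ ⟦ gs ⟧ ≈ᴹ ⟦ twist gs ⟧
    Φ⟦⟧ []       = Φ.0-hom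
    Φ⟦⟧ (g ∷ gs) = begin
      Φⱽ (j g +ᴹ z *ₗ ⟦ gs ⟧)                      ≈⟨ Φ.+-hom _ _ ⟩
      Φⱽ (j g) +ᴹ Φⱽ (z *ₗ ⟦ gs ⟧)                 ≈⟨ +ᴹ-cong (Φ-commutes g) (Φ.*ₗ-hom z _) ⟩
      j (Φᵂ g) +ᴹ φ′ z *ₗ Φⱽ ⟦ gs ⟧                ≈⟨ +ᴹ-congˡ (*ₗ-cong φ′z (Φ⟦⟧ gs)) ⟩
      j (Φᵂ g) +ᴹ (ι q * z) *ₗ ⟦ twist gs ⟧        ≈⟨ +ᴹ-congˡ (*ₗ-congʳ (Field.*-comm L _ _)) ⟩
      j (Φᵂ g) +ᴹ (z * ι q) *ₗ ⟦ twist gs ⟧        ≈⟨ +ᴹ-congˡ (*ₗ-assoc _ _ _) ⟩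
      j (Φᵂ g) +ᴹ z *ₗ (ι q *ₗ ⟦ twist gs ⟧)       ≈⟨ +ᴹ-congˡ (*ₗ-congˡ (⟦map-*ₗ⟧ q (twist gs))) ⟨
      j (Φᵂ g) +ᴹ z *ₗ ⟦ map (q W.*ₗ_) (twist gs) ⟧ ∎

⊤-isSubspace : ∀ {a} {F : Field a} (M : VectorSpace F) → IsSubspace {F = F} M (λ _ → ⊤)
⊤-isSubspace M = record { resp = λ _ _ → tt ; has0 = tt ; +-cl = λ _ _ → tt ; *ₗ-cl = λ _ _ → tt }

module Polynomials {a : Level} {K L : Field a} {ι : Field.Carrier K → Field.Carrier L}
                   (ι-hom : IsFieldHom K L ι) (z : Field.Carrier L) where
  open Field L
  open Horner {K = K} {L = L} z (fieldHom⇒semilinear ι-hom) public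
    using (IsPolynomial; ⟦⟧-isPolynomial; polynomialIn-isKzSubmodule; module Twist)
    renaming (⟦_⟧ to poly)

  evalPoly≡poly : ∀ p → evalPoly L (map ι p) z ≡ poly p
  evalPoly≡poly []       = ≡.refl
  evalPoly≡poly (c ∷ cs) = ≡.cong (λ x → ι c + z * x) (evalPoly≡poly cs)

  poly-*ₗ-closed : ∀ {M : VectorSpace L} {X : Pred (Module.Carrierᴹ M) a} →
                   IsKzSubmodule {K = K} {L = L} ι z M X → ∀ p {v} → X v → X (Module._*ₗ_ M (poly p) v)
  poly-*ₗ-closed {M} X-submodule []       {v} Xv = resp (≈ᴹ-sym (*ₗ-zeroˡ v)) has0
    where
    open Module M
    open IsKzSubmodule X-submodule
  poly-*ₗ-closed {M} X-submodule (c ∷ cs) {v} Xv =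
    resp (≈ᴹ-sym (≈ᴹ-trans (*ₗ-distribʳ v _ _) (+ᴹ-congˡ (*ₗ-assoc z (poly cs) v))))
         (+-cl (ι-*ₗ-cl c Xv) (z-*ₗ-cl (poly-*ₗ-closed X-submodule cs Xv)))
    where
    open Module M
    open IsKzSubmodule X-submodule

  poly-*-isPolynomial : ∀ p p′ → IsPolynomial (poly p * poly p′)
  poly-*-isPolynomial p p′ =
    poly-*ₗ-closed (polynomialIn-isKzSubmodule (⊤-isSubspace {F = K} ⟨module⟩)) p (⟦⟧-isPolynomial p′)

module _ {a : Level} {K : Field a} {φ : Field.Carrier K → Field.Carrier K} (W : PhiModule K φ) where
  open PhiModule W

  phiSubmodule⇒subspace : ∀ {P} → IsPhiSubmodule W P → IsSubspace {F = K} space P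
  phiSubmodule⇒subspace P-sub = record { resp = resp ; has0 = has0 ; +-cl = +-cl ; *ₗ-cl = *ₗ-cl }
    where
    open IsPhiSubmodule P-sub

  ⊤-isPhiSubmodule : IsPhiSubmodule W (λ _ → ⊤)
  ⊤-isPhiSubmodule = record { resp = λ _ _ → tt ; has0 = tt ; +-cl = λ _ _ → tt ; *ₗ-cl = λ _ _ → tt ; Φ-cl = λ _ → tt }

  Φ-isSemilinear : IsSemilinear {K = K} {L = K} φ space space Φ
  Φ-isSemilinear = record { cong = Φ-cong ; +-hom = Φ-+ ; *ₗ-hom = Φ-semilinear }

module BaseChange {a : Level} (em : ExcludedMiddle a)
  (K : Field a) (φ : Field.Carrier K → Field.Carrier K) (q : Field.Carrier K)
  (L : Field a) (ι : Field.Carrier K → Field.Carrier L) (z : Field.Carrier L)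
  (purelyTranscendental : IsPurelyTranscendental K L ι z)
  (φ′ : Field.Carrier L → Field.Carrier L) (φ′-automorphism : IsAutomorphism L φ′)
  (φ′∘ι≈ι∘φ : ∀ c → Field._≈_ L (φ′ (ι c)) (ι (φ c)))
  (φ′z≈qz : Field._≈_ L (φ′ z) (Field._*_ L (ι q) z))
  (W : PhiModule K φ) (V : PhiModule L φ′)
  (j : Module.Carrierᴹ (PhiModule.space W) → Module.Carrierᴹ (PhiModule.space V))
  (baseChange : IsBaseChange {K = K} {L = L} ι (PhiModule.space W) (PhiModule.space V) j)
  (Φ∘j≈j∘Φ : ∀ w → Module._≈ᴹ_ (PhiModule.space V) (PhiModule.Φ V (j w)) (j (PhiModule.Φ W w)))
  where
  private
    module K = Field K
    module W = PhiModule W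
    module Wᴹ = Module W.space
    module Wˢ = VectorSpaceProperties {F = K} W.space
    module V = PhiModule V
    module PT = IsPurelyTranscendental purelyTranscendental
    module BC = IsBaseChange baseChange
    module ι = IsSemilinear (fieldHom⇒semilinear PT.ι-hom)
    module φ′ = IsAutomorphism φ′-automorphism
  open Field L hiding (zero)
  open Module V.space
  open VectorSpaceProperties {F = L} V.space
  open SetoidReasoning ≈ᴹ-setoid
  open FieldProperties L using (inv; x≉0∧x*y≈0⇒y≈0; x≉0∧y≉0⇒x*y≉0)
  open Dimension em {F = L} V.space using (independent⇒spans)
  open Polynomials PT.ι-hom z using (poly; evalPoly≡poly; poly-*ₗ-closed; poly-*-isPolynomial)
  private module PolyTwist = Polynomials.Twist PT.ι-hom z
            (fieldHom⇒semilinear (IsAutomorphism.isHom φ′-automorphism)) φ′∘ι≈ι∘φ q φ′z≈qz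

  j-semilinear : IsSemilinear {K = K} {L = L} ι W.space V.space j
  j-semilinear = record { cong = BC.j-cong ; +-hom = BC.j-+ ; *ₗ-hom = BC.j-*ₗ }
  private module J = IsSemilinear j-semilinear

  open Horner z j-semilinear
  private module WTwist = Twist (Φ-isSemilinear V) Φ∘j≈j∘Φ q φ′z≈qz

  transcendental : ∀ p → poly p ≈ 0# → All (K._≈ K.0#) p
  transcendental p p≈0 = PT.transcendental p (trans (reflexive (evalPoly≡poly p)) p≈0)

  generated : ∀ x → Σ (List K.Carrier) λ p → Σ (List K.Carrier) λ r →
              ¬ (poly r ≈ 0#) × x * poly r ≈ poly p
  generated x with PT.generated x
  ... | p , r , r≉0 , xr≈p =
    p , r , (λ r≈0 → r≉0 (trans (reflexive (evalPoly≡poly r)) r≈0)) ,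
    trans (*-congˡ (reflexive (≡.sym (evalPoly≡poly r)))) (trans xr≈p (reflexive (evalPoly≡poly p)))

  z≉0 : ¬ (z ≈ 0#)
  z≉0 z≈0 with transcendental (K.0# ∷ K.1# ∷ []) z·1≈0
    where
    z·1≈0 : poly (K.0# ∷ K.1# ∷ []) ≈ 0#
    z·1≈0 = trans (+-cong ι.0-hom (trans (*-congʳ z≈0) (zeroˡ _))) (+-identityˡ 0#)
  ... | _ ∷ 1≈0 ∷ [] = K.1#≉0# 1≈0

  twist-nonzero : ∀ p → ¬ (poly p ≈ 0#) → ¬ (poly (PolyTwist.twist p) ≈ 0#)
  twist-nonzero p p≉0 twist≈0 =
    p≉0 (φ′.injective _ 0# (trans (PolyTwist.Φ⟦⟧ p) (trans twist≈0 (sym φ′-0))))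
    where
    φ′-0 : φ′ 0# ≈ 0#
    φ′-0 = IsSemilinear.0-hom (fieldHom⇒semilinear φ′.isHom)

  n : ℕ
  n = proj₁ W.finiteDim

  e : Fin n → Wᴹ.Carrierᴹ
  e = proj₁ (proj₂ W.finiteDim)

  ε : Fin n → Carrierᴹ
  ε = j ∘ e

  e-basis : IsBasis {K = K} W.space e
  e-basis = proj₂ (proj₂ W.finiteDim)

  ε-basis : IsBasis {K = L} V.space ε
  ε-basis = BC.j-basis n e e-basis

  private
    module e = Wˢ.Coordinates e-basis
    module ε = Coordinates ε-basis

  polyᵛ : ∀ {N} → Vec K.Carrier N → Carrier
  polyᵛ v = poly (toList v)

  polyᵛ-[] : (v : Vec K.Carrier 0) → polyᵛ v ≈ 0#
  polyᵛ-[] [] = refl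

  polyᵛ-∷ : ∀ {N} (v : Vec K.Carrier (suc N)) → polyᵛ v ≈ ι (Vec.head v) + z * polyᵛ (Vec.tail v)
  polyᵛ-∷ (c ∷ cs) = refl

  coordinatePolynomial : (gs : List Wᴹ.Carrierᴹ) → Fin n → Vec K.Carrier (length gs)
  coordinatePolynomial []       i = []
  coordinatePolynomial (g ∷ gs) i = e.coord g i ∷ coordinatePolynomial gs i

  ⟦⟧-coordinates : ∀ gs → ⟦ gs ⟧ ≈ᴹ ∑ᴹ (λ i → polyᵛ (coordinatePolynomial gs i) *ₗ ε i)
  ⟦⟧-coordinates []       = ≈ᴹ-sym (∑-zero {n} (λ i → *ₗ-zeroˡ (ε i)))
  ⟦⟧-coordinates (g ∷ gs) = begin
    j g +ᴹ z *ₗ ⟦ gs ⟧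
      ≈⟨ +ᴹ-cong (J.cong (e.coord-spec g)) (*ₗ-congˡ (⟦⟧-coordinates gs)) ⟩
    j (Wˢ.∑ᴹ (λ i → e.coord g i Wᴹ.*ₗ e i)) +ᴹ z *ₗ ∑ᴹ (λ i → P gs i *ₗ ε i)
      ≈⟨ +ᴹ-cong (≈ᴹ-trans (J.∑-hom {n} _) (∑-cong {n} (λ i → J.*ₗ-hom _ _))) (*ₗ-distrib-∑ {n} z _) ⟩
    ∑ᴹ (λ i → ι (e.coord g i) *ₗ ε i) +ᴹ ∑ᴹ (λ i → z *ₗ (P gs i *ₗ ε i))
      ≈⟨ ∑-distrib-+ {n} _ _ ⟨
    ∑ᴹ (λ i → ι (e.coord g i) *ₗ ε i +ᴹ z *ₗ (P gs i *ₗ ε i))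
      ≈⟨ ∑-cong {n} (λ i → ≈ᴹ-trans (+ᴹ-congˡ (≈ᴹ-sym (*ₗ-assoc _ _ _))) (≈ᴹ-sym (*ₗ-distribʳ _ _ _))) ⟩
    ∑ᴹ (λ i → P (g ∷ gs) i *ₗ ε i) ∎
    where
    P : (gs : List Wᴹ.Carrierᴹ) → Fin n → Carrier
    P gs i = polyᵛ (coordinatePolynomial gs i)

  HasConstantTerm : Wᴹ.Carrierᴹ → Carrierᴹ → Set a
  HasConstantTerm w x = Σ (List Wᴹ.Carrierᴹ) λ gs → x ≈ᴹ ⟦ w ∷ gs ⟧

  constantTerm-zero : ∀ {w x} → HasConstantTerm w x → x ≈ᴹ 0ᴹ → w Wᴹ.≈ᴹ Wᴹ.0ᴹ
  constantTerm-zero {w} {x} (gs , x≈) x≈0 =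
    Wᴹ.≈ᴹ-trans (e.coord-spec w) (Wˢ.∑-zero {n} (λ i → Wᴹ.≈ᴹ-trans (Wᴹ.*ₗ-congʳ (coord≈0 i)) (Wᴹ.*ₗ-zeroˡ _)))
    where
    coordinates≈0 : ∀ i → polyᵛ (coordinatePolynomial (w ∷ gs) i) ≈ 0#
    coordinates≈0 = IsBasis.independent ε-basis _
                      (≈ᴹ-trans (≈ᴹ-sym (⟦⟧-coordinates (w ∷ gs))) (≈ᴹ-trans (≈ᴹ-sym x≈) x≈0))
    coord≈0 : ∀ i → e.coord w i K.≈ K.0#
    coord≈0 i with transcendental (toList (coordinatePolynomial (w ∷ gs) i)) (coordinates≈0 i)
    ... | c≈0 ∷ _ = c≈0

  hasConstantTerm-resp : ∀ {w w′ x x′} → w Wᴹ.≈ᴹ w′ → x ≈ᴹ x′ → HasConstantTerm w x → HasConstantTerm w′ x′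
  hasConstantTerm-resp w≈w′ x≈x′ (gs , x≈) = gs , ≈ᴹ-trans (≈ᴹ-sym x≈x′) (≈ᴹ-trans x≈ (+ᴹ-congʳ (J.cong w≈w′)))

  hasConstantTerm-j : ∀ w → HasConstantTerm w (j w)
  hasConstantTerm-j w = [] , ≈ᴹ-sym (≈ᴹ-trans (+ᴹ-congˡ (*ₗ-zeroʳ z)) (+ᴹ-identityʳ _))

  hasConstantTerm-0 : HasConstantTerm Wᴹ.0ᴹ 0ᴹ
  hasConstantTerm-0 = hasConstantTerm-resp Wᴹ.≈ᴹ-refl J.0-hom (hasConstantTerm-j Wᴹ.0ᴹ)

  hasConstantTerm-+ : ∀ {w w′ x x′} → HasConstantTerm w x → HasConstantTerm w′ x′ →
                      HasConstantTerm (w Wᴹ.+ᴹ w′) (x +ᴹ x′)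
  hasConstantTerm-+ {w} {w′} (gs , x≈) (gs′ , x′≈) =
    gs ⊕ gs′ , ≈ᴹ-trans (+ᴹ-cong x≈ x′≈) (≈ᴹ-sym (⟦⊕⟧ (w ∷ gs) (w′ ∷ gs′)))

  hasConstantTerm-ι*ₗ : ∀ c {w x} → HasConstantTerm w x → HasConstantTerm (c Wᴹ.*ₗ w) (ι c *ₗ x)
  hasConstantTerm-ι*ₗ c {w} (gs , x≈) =
    map (c Wᴹ.*ₗ_) gs , ≈ᴹ-trans (*ₗ-congˡ x≈) (≈ᴹ-sym (⟦map-*ₗ⟧ c (w ∷ gs)))

  hasConstantTerm-Φ : ∀ {w x} → HasConstantTerm w x → HasConstantTerm (W.Φ w) (V.Φ x)
  hasConstantTerm-Φ {w} (gs , x≈) = map (q Wᴹ.*ₗ_) (WTwist.twist gs) , ≈ᴹ-trans (V.Φ-cong x≈) (WTwist.Φ⟦⟧ (w ∷ gs))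

  isPolynomial-poly*ₗ : ∀ p {x} → IsPolynomial x → IsPolynomial (poly p *ₗ x)
  isPolynomial-poly*ₗ = poly-*ₗ-closed (polynomialIn-isKzSubmodule (⊤-isSubspace W.space))

  hasConstantTerm-polyᵛ*ₗ : ∀ {N} (v : Vec K.Carrier (suc N)) {w x} → HasConstantTerm w x →
                            HasConstantTerm (Vec.head v Wᴹ.*ₗ w) (polyᵛ v *ₗ x)
  hasConstantTerm-polyᵛ*ₗ (c ∷ cs) {w} {x} (gs , x≈) =
    hasConstantTerm-resp (Wᴹ.+ᴹ-identityʳ _) (≈ᴹ-sym polyᵛ*ₗx≈)
      (hasConstantTerm-+ (hasConstantTerm-ι*ₗ c (gs , x≈)) (hs , ≈ᴹ-trans (*ₗ-congˡ hs≈) (≈ᴹ-sym (⟦0∷⟧ hs))))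
    where
    higher : IsPolynomial (polyᵛ cs *ₗ x)
    higher = isPolynomial-poly*ₗ (toList cs) (w ∷ gs , universal (λ _ → tt) (w ∷ gs) , x≈)
    hs = proj₁ higher
    hs≈ = proj₂ (proj₂ higher)
    polyᵛ*ₗx≈ : polyᵛ (c ∷ cs) *ₗ x ≈ᴹ ι c *ₗ x +ᴹ z *ₗ (polyᵛ cs *ₗ x)
    polyᵛ*ₗx≈ = ≈ᴹ-trans (*ₗ-distribʳ x _ _) (+ᴹ-congˡ (*ₗ-assoc _ _ _))

  hasConstantTerm-∑ : ∀ {m} {w : Fin m → Wᴹ.Carrierᴹ} {x : Fin m → Carrierᴹ} →
                      (∀ i → HasConstantTerm (w i) (x i)) → HasConstantTerm (Wˢ.∑ᴹ w) (∑ᴹ x)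
  hasConstantTerm-∑ {zero}  _   = hasConstantTerm-0
  hasConstantTerm-∑ {suc m} wx = hasConstantTerm-+ (wx zero) (hasConstantTerm-∑ (wx ∘ suc))

  constantTerm-unique : ∀ {w w′ x} → HasConstantTerm w x → HasConstantTerm w′ x → w Wᴹ.≈ᴹ w′
  constantTerm-unique {w} {w′} {x} wx w′x = W-group.x∙y⁻¹≈ε⇒x≈y w w′
    (constantTerm-zero (hasConstantTerm-resp (Wᴹ.+ᴹ-congˡ (Wˢ.-1*ₗv≈-v w′)) x-x≈0 difference) ≈ᴹ-refl)
    where
    module W-group = GroupProperties Wᴹ.+ᴹ-group
    ι-1≈-1 : ι (K.- K.1#) ≈ - 1#
    ι-1≈-1 = trans (ι.-ᴹ-hom K.1#) (-‿cong (IsFieldHom.1-hom PT.ι-hom))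
    difference : HasConstantTerm (w Wᴹ.+ᴹ (K.- K.1#) Wᴹ.*ₗ w′) (x +ᴹ ι (K.- K.1#) *ₗ x)
    difference = hasConstantTerm-+ wx (hasConstantTerm-ι*ₗ (K.- K.1#) w′x)
    x-x≈0 : x +ᴹ ι (K.- K.1#) *ₗ x ≈ᴹ 0ᴹ
    x-x≈0 = ≈ᴹ-trans (+ᴹ-congˡ (≈ᴹ-trans (*ₗ-congʳ ι-1≈-1) (-1*ₗv≈-v x))) (-ᴹ‿inverseʳ x)

  isPolynomial-j : ∀ w → IsPolynomial (j w)
  isPolynomial-j w = w ∷ [] , tt ∷ [] , proj₂ (hasConstantTerm-j w)

  ∷-injective : ∀ {g g′ y y′} → IsPolynomial y → IsPolynomial y′ →
                j g +ᴹ z *ₗ y ≈ᴹ j g′ +ᴹ z *ₗ y′ → g Wᴹ.≈ᴹ g′ × y ≈ᴹ y′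
  ∷-injective {g} {g′} {y} {y′} (hs , _ , y≈) (hs′ , _ , y′≈) eq =
    g≈g′ , *ₗ-cancelˡ z≉0 (∙-cancelˡ (j g) _ _ (begin
      j g +ᴹ z *ₗ y     ≈⟨ eq ⟩
      j g′ +ᴹ z *ₗ y′   ≈⟨ +ᴹ-congʳ (J.cong g≈g′) ⟨
      j g +ᴹ z *ₗ y′    ∎))
    where
    g≈g′ : g Wᴹ.≈ᴹ g′
    g≈g′ = constantTerm-unique (hs , +ᴹ-congˡ (*ₗ-congˡ y≈)) (hs′ , ≈ᴹ-trans eq (+ᴹ-congˡ (*ₗ-congˡ y′≈)))

  module Span {P : Pred Wᴹ.Carrierᴹ a} (P-sub : IsPhiSubmodule W P) where
    private
      module P = IsPhiSubmodule P-sub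
      P-subspace = phiSubmodule⇒subspace W P-sub
      X-sub = polynomialIn-isKzSubmodule P-subspace
      module X = IsKzSubmodule X-sub

    -- The L-span of j P, described by clearing denominators.
    InSpan : Pred Carrierᴹ a
    InSpan v = Σ (List K.Carrier) λ p → ¬ (poly p ≈ 0#) × IsPolynomialIn P (poly p *ₗ v)

    private
      poly1≈1 : poly (K.1# ∷ []) ≈ 1#
      poly1≈1 = trans (+-cong (IsFieldHom.1-hom PT.ι-hom) (zeroʳ z)) (+-identityʳ 1#)

      inSpan-poly1 : ∀ {v} → IsPolynomialIn P v → InSpan v
      inSpan-poly1 Xv = K.1# ∷ [] , (λ p≈0 → 1#≉0# (trans (sym poly1≈1) p≈0)) ,
                        X.resp (≈ᴹ-sym (≈ᴹ-trans (*ₗ-congʳ poly1≈1) (*ₗ-identityˡ _))) Xv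

    inSpan-j : ∀ {w} → P w → InSpan (j w)
    inSpan-j {w} Pw = inSpan-poly1 (w ∷ [] , Pw ∷ [] , ≈ᴹ-sym (≈ᴹ-trans (+ᴹ-congˡ (*ₗ-zeroʳ z)) (+ᴹ-identityʳ _)))

    inSpan-+ : ∀ {v w} → InSpan v → InSpan w → InSpan (v +ᴹ w)
    inSpan-+ {v} {w} (p , p≉0 , Xpv) (p′ , p′≉0 , Xp′w) =
      p″ , (λ p″≈0 → x≉0∧y≉0⇒x*y≉0 p≉0 p′≉0 (trans pp′≈p″ p″≈0)) ,
      X.resp combination≈ (X.+-cl (poly-*ₗ-closed X-sub p′ Xpv) (poly-*ₗ-closed X-sub p Xp′w))
      where
      p″ = proj₁ (poly-*-isPolynomial p p′)
      pp′≈p″ = proj₂ (proj₂ (poly-*-isPolynomial p p′))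
      combination≈ : poly p′ *ₗ (poly p *ₗ v) +ᴹ poly p *ₗ (poly p′ *ₗ w) ≈ᴹ poly p″ *ₗ (v +ᴹ w)
      combination≈ = begin
        poly p′ *ₗ (poly p *ₗ v) +ᴹ poly p *ₗ (poly p′ *ₗ w)   ≈⟨ +ᴹ-congʳ (*ₗ-comm _ _ _) ⟩
        poly p *ₗ (poly p′ *ₗ v) +ᴹ poly p *ₗ (poly p′ *ₗ w)   ≈⟨ +ᴹ-cong (*ₗ-assoc _ _ _) (*ₗ-assoc _ _ _) ⟨
        (poly p * poly p′) *ₗ v +ᴹ (poly p * poly p′) *ₗ w     ≈⟨ *ₗ-distribˡ _ _ _ ⟨
        (poly p * poly p′) *ₗ (v +ᴹ w)                         ≈⟨ *ₗ-congʳ pp′≈p″ ⟩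
        poly p″ *ₗ (v +ᴹ w)                                    ∎

    -- A scalar c = s(z)/r(z) is absorbed by enlarging the denominator by r(z).
    inSpan-*ₗ : ∀ c {v} → InSpan v → InSpan (c *ₗ v)
    inSpan-*ₗ c {v} (p , p≉0 , Xpv) =
      p″ , (λ p″≈0 → x≉0∧y≉0⇒x*y≉0 r≉0 p≉0 (trans rp≈p″ p″≈0)) ,
      X.resp combination≈ (poly-*ₗ-closed X-sub s Xpv)
      where
      s = proj₁ (generated c)
      r = proj₁ (proj₂ (generated c))
      r≉0 = proj₁ (proj₂ (proj₂ (generated c)))
      cr≈s = proj₂ (proj₂ (proj₂ (generated c)))
      p″ = proj₁ (poly-*-isPolynomial r p)
      rp≈p″ = proj₂ (proj₂ (poly-*-isPolynomial r p))
      combination≈ : poly s *ₗ (poly p *ₗ v) ≈ᴹ poly p″ *ₗ (c *ₗ v)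
      combination≈ = begin
        poly s *ₗ (poly p *ₗ v)          ≈⟨ *ₗ-congʳ cr≈s ⟨
        (c * poly r) *ₗ (poly p *ₗ v)    ≈⟨ *ₗ-congʳ (*-comm _ _) ⟩
        (poly r * c) *ₗ (poly p *ₗ v)    ≈⟨ *ₗ-assoc _ _ _ ⟩
        poly r *ₗ (c *ₗ (poly p *ₗ v))   ≈⟨ *ₗ-congˡ (*ₗ-comm _ _ _) ⟩
        poly r *ₗ (poly p *ₗ (c *ₗ v))   ≈⟨ *ₗ-assoc _ _ _ ⟨
        (poly r * poly p) *ₗ (c *ₗ v)    ≈⟨ *ₗ-congʳ rp≈p″ ⟩
        poly p″ *ₗ (c *ₗ v)              ∎

    inSpan-Φ : ∀ {v} → InSpan v → InSpan (V.Φ v)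
    inSpan-Φ {v} (p , p≉0 , gs , Pgs , pv≈) =
      PolyTwist.twist p , twist-nonzero p p≉0 , WTwist.twist gs , All-twist Pgs , (begin
        poly (PolyTwist.twist p) *ₗ V.Φ v   ≈⟨ *ₗ-congʳ (PolyTwist.Φ⟦⟧ p) ⟨
        φ′ (poly p) *ₗ V.Φ v                ≈⟨ V.Φ-semilinear _ _ ⟨
        V.Φ (poly p *ₗ v)                   ≈⟨ V.Φ-cong pv≈ ⟩
        V.Φ ⟦ gs ⟧                          ≈⟨ WTwist.Φ⟦⟧ gs ⟩
        ⟦ WTwist.twist gs ⟧                 ∎)
      where
      All-twist : ∀ {gs} → All P gs → All P (WTwist.twist gs)
      All-twist []         = []
      All-twist (Pg ∷ Pgs) = P.Φ-cl Pg ∷ All-map-*ₗ P-subspace q (All-twist Pgs)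

    isPhiSubmodule : IsPhiSubmodule V InSpan
    isPhiSubmodule = record
      { resp  = λ v≈w (p , p≉0 , Xpv) → p , p≉0 , X.resp (*ₗ-congˡ v≈w) Xpv
      ; has0  = inSpan-poly1 X.has0
      ; +-cl  = inSpan-+
      ; *ₗ-cl = inSpan-*ₗ
      ; Φ-cl  = inSpan-Φ
      }

    private
      polynomialIn-uncons : ∀ {x} → IsPolynomialIn P x →
                            Σ Wᴹ.Carrierᴹ λ g → Σ (List Wᴹ.Carrierᴹ) λ gs → P g × All P gs × x ≈ᴹ ⟦ g ∷ gs ⟧
      polynomialIn-uncons ([] , [] , x≈0) =
        Wᴹ.0ᴹ , [] , P.has0 , [] , ≈ᴹ-trans x≈0 (≈ᴹ-sym (≈ᴹ-trans (⟦0∷⟧ []) (*ₗ-zeroʳ z)))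
      polynomialIn-uncons (g ∷ gs , Pg ∷ Pgs , x≈) = g , gs , Pg , Pgs , x≈

    -- Strip factors z off p(z); at its lowest nonzero coefficient c, comparing constant terms gives c w ∈ P.
    inSpan-j⁻¹ : ∀ {w} → InSpan (j w) → P w
    inSpan-j⁻¹ (p , p≉0 , Xpjw) = strip p p≉0 Xpjw
      where
      strip : ∀ p {w} → ¬ (poly p ≈ 0#) → IsPolynomialIn P (poly p *ₗ j w) → P w
      strip []       p≉0 _ = ⊥-elim (p≉0 refl)
      strip (c ∷ cs) {w} p≉0 Xpjw with polynomialIn-uncons Xpjw
      ... | g , gs , Pg , Pgs , pjw≈ with ∷-injective (isPolynomial-poly*ₗ cs (isPolynomial-j w))
                                                      (⟦⟧-isPolynomial gs)
                                                      (≈ᴹ-trans (≈ᴹ-sym expand) pjw≈)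
        where
        expand : poly (c ∷ cs) *ₗ j w ≈ᴹ j (c Wᴹ.*ₗ w) +ᴹ z *ₗ (poly cs *ₗ j w)
        expand = ≈ᴹ-trans (*ₗ-distribʳ (j w) _ _) (+ᴹ-cong (≈ᴹ-sym (J.*ₗ-hom c w)) (*ₗ-assoc _ _ _))
      ...   | cw≈g , csjw≈gs with em {c K.≈ K.0#}
      ...     | no  c≉0 = P.resp (Wᴹ.≈ᴹ-trans (Wᴹ.*ₗ-congˡ (Wᴹ.≈ᴹ-sym cw≈g)) (Wˢ.inv-*ₗ-cancel c≉0 w))
                                 (P.*ₗ-cl _ Pg)
      ...     | yes c≈0 = strip cs cs≉0 (gs , Pgs , csjw≈gs)
        where
        cs≉0 : ¬ (poly cs ≈ 0#)
        cs≉0 cs≈0 = p≉0 (trans (+-cong (trans (ι.cong c≈0) ι.0-hom) (trans (*-congˡ cs≈0) (zeroʳ z)))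
                               (+-identityˡ 0#))

  clearDenominators : ∀ v → Span.InSpan (⊤-isPhiSubmodule W) v
  clearDenominators = spans⇒full (phiSubmodule⇒subspace V (Span.isPhiSubmodule (⊤-isPhiSubmodule W)))
                        (IsBasis.spanning ε-basis) (λ i → Span.inSpan-j (⊤-isPhiSubmodule W) tt)

  irreducible-descends : Irreducible V → Irreducible W
  irreducible-descends irreducibleⱽ P P-sub
    with irreducibleⱽ (Span.InSpan P-sub) (Span.isPhiSubmodule P-sub)
  ... | inj₁ span≈0   = inj₁ λ w Pw →
    constantTerm-zero (hasConstantTerm-j w) (span≈0 (j w) (Span.inSpan-j P-sub Pw))
  ... | inj₂ span-full = inj₂ λ w → Span.inSpan-j⁻¹ P-sub (span-full (j w))

  module ConstantTerms {Q : Pred Carrierᴹ a} (Q-sub : IsPhiSubmodule V Q) where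
    private module Q = IsPhiSubmodule Q-sub

    ConstantTerm : Pred Wᴹ.Carrierᴹ a
    ConstantTerm w = Σ Carrierᴹ λ x → Q x × HasConstantTerm w x

    isPhiSubmodule : IsPhiSubmodule W ConstantTerm
    isPhiSubmodule = record
      { resp  = λ w≈w′ (x , Qx , wx) → x , Qx , hasConstantTerm-resp w≈w′ ≈ᴹ-refl wx
      ; has0  = 0ᴹ , Q.has0 , hasConstantTerm-0
      ; +-cl  = λ (x , Qx , wx) (x′ , Qx′ , wx′) → x +ᴹ x′ , Q.+-cl Qx Qx′ , hasConstantTerm-+ wx wx′
      ; *ₗ-cl = λ c (x , Qx , wx) → ι c *ₗ x , Q.*ₗ-cl (ι c) Qx , hasConstantTerm-ι*ₗ c wx
      ; Φ-cl  = λ (x , Qx , wx) → V.Φ x , Q.Φ-cl Qx , hasConstantTerm-Φ wx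
      }

    lowest-coefficient : ∀ gs → Q ⟦ gs ⟧ → ¬ (⟦ gs ⟧ ≈ᴹ 0ᴹ) →
                         Σ Wᴹ.Carrierᴹ λ w → ConstantTerm w × ¬ (w Wᴹ.≈ᴹ Wᴹ.0ᴹ)
    lowest-coefficient []       _    ⟦⟧≉0 = ⊥-elim (⟦⟧≉0 ≈ᴹ-refl)
    lowest-coefficient (g ∷ gs) Q⟦⟧ ⟦⟧≉0 with em {g Wᴹ.≈ᴹ Wᴹ.0ᴹ}
    ... | no  g≉0 = g , (⟦ g ∷ gs ⟧ , Q⟦⟧ , gs , ≈ᴹ-refl) , g≉0
    ... | yes g≈0 = lowest-coefficient gs Q⟦gs⟧ (λ ⟦gs⟧≈0 → ⟦⟧≉0 (≈ᴹ-trans ⟦⟧≈z⟦gs⟧ (≈ᴹ-trans (*ₗ-congˡ ⟦gs⟧≈0) (*ₗ-zeroʳ z))))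
      where
      ⟦⟧≈z⟦gs⟧ : ⟦ g ∷ gs ⟧ ≈ᴹ z *ₗ ⟦ gs ⟧
      ⟦⟧≈z⟦gs⟧ = ≈ᴹ-trans (+ᴹ-congʳ (J.cong g≈0)) (⟦0∷⟧ gs)
      Q⟦gs⟧ : Q ⟦ gs ⟧
      Q⟦gs⟧ = Q.resp (inv-*ₗ-cancel z≉0 _) (Q.*ₗ-cl (inv z z≉0) (Q.resp ⟦⟧≈z⟦gs⟧ Q⟦⟧))

    trivial⇒trivial : (∀ w → ConstantTerm w → w Wᴹ.≈ᴹ Wᴹ.0ᴹ) → ∀ v → Q v → v ≈ᴹ 0ᴹ
    trivial⇒trivial trivial v Qv with em {v ≈ᴹ 0ᴹ}
    ... | yes v≈0 = v≈0
    ... | no  v≉0 with clearDenominators v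
    ...   | p , p≉0 , gs , _ , pv≈ with lowest-coefficient gs (Q.resp pv≈ (Q.*ₗ-cl (poly p) Qv))
                                          (λ ⟦gs⟧≈0 → v≉0 (c≉0∧c*v≈0⇒v≈0 p≉0 (≈ᴹ-trans pv≈ ⟦gs⟧≈0)))
    ...     | w , Rw , w≉0 = ⊥-elim (w≉0 (trivial w Rw))

    module _ (full : ∀ w → ConstantTerm w) where
      private
        x : Fin n → Carrierᴹ
        x i = proj₁ (full (e i))

        Qx : ∀ i → Q (x i)
        Qx i = proj₁ (proj₂ (full (e i)))

        e-x : ∀ i → HasConstantTerm (e i) (x i)
        e-x i = proj₂ (proj₂ (full (e i)))

      -- Induction on the degree bound: the constant terms of the relation form a K-relation
      -- among the basis vectors e i, so all coefficients are divisible by z.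
      polynomial-relation-trivial : ∀ N (d : Fin n → Vec K.Carrier N) →
                                    ∑ᴹ (λ i → polyᵛ (d i) *ₗ x i) ≈ᴹ 0ᴹ → ∀ i → polyᵛ (d i) ≈ 0#
      polynomial-relation-trivial zero    d _        i = polyᵛ-[] (d i)
      polynomial-relation-trivial (suc N) d relation i =
        trans (d≈z*tail i) (trans (*-congˡ (tails≈0 i)) (zeroʳ z))
        where
        heads≈0 : ∀ i → Vec.head (d i) K.≈ K.0#
        heads≈0 = IsBasis.independent e-basis (λ i → Vec.head (d i))
                    (constantTerm-zero (hasConstantTerm-∑ (λ i → hasConstantTerm-polyᵛ*ₗ (d i) (e-x i))) relation)
        d≈z*tail : ∀ i → polyᵛ (d i) ≈ z * polyᵛ (Vec.tail (d i))
        d≈z*tail i = trans (polyᵛ-∷ (d i)) (trans (+-congʳ (trans (ι.cong (heads≈0 i)) ι.0-hom)) (+-identityˡ _))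
        tails≈0 : ∀ i → polyᵛ (Vec.tail (d i)) ≈ 0#
        tails≈0 = polynomial-relation-trivial N (Vec.tail ∘ d) (c≉0∧c*v≈0⇒v≈0 z≉0 (begin
          z *ₗ ∑ᴹ (λ i → polyᵛ (Vec.tail (d i)) *ₗ x i)     ≈⟨ *ₗ-distrib-∑ {n} z _ ⟩
          ∑ᴹ (λ i → z *ₗ (polyᵛ (Vec.tail (d i)) *ₗ x i))   ≈⟨ ∑-cong {n} (λ i →
                                                                 ≈ᴹ-trans (≈ᴹ-sym (*ₗ-assoc _ _ _))
                                                                          (*ₗ-congʳ (sym (d≈z*tail i)))) ⟩
          ∑ᴹ (λ i → polyᵛ (d i) *ₗ x i)                     ≈⟨ relation ⟩
          0ᴹ                                               ∎))

      x-independent : LinearlyIndependent x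
      x-independent c relation i =
        x≉0∧x*y≈0⇒y≈0 p≉0 (trans (pc≈d i) (polynomial-relation-trivial (length gs) d d-relation i))
        where
        cleared = clearDenominators (∑ᴹ (λ i → c i *ₗ ε i))
        p = proj₁ cleared
        p≉0 = proj₁ (proj₂ cleared)
        gs = proj₁ (proj₂ (proj₂ cleared))
        pv≈ = proj₂ (proj₂ (proj₂ (proj₂ cleared)))
        d : Fin n → Vec K.Carrier (length gs)
        d = coordinatePolynomial gs
        pc≈d : ∀ i → poly p * c i ≈ polyᵛ (d i)
        pc≈d = ε.coordinates-unique _ _ (begin
          ∑ᴹ (λ i → (poly p * c i) *ₗ ε i)    ≈⟨ ∑-cong {n} (λ i → *ₗ-assoc _ _ _) ⟩
          ∑ᴹ (λ i → poly p *ₗ (c i *ₗ ε i))   ≈⟨ *ₗ-distrib-∑ {n} _ _ ⟨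
          poly p *ₗ ∑ᴹ (λ i → c i *ₗ ε i)     ≈⟨ pv≈ ⟩
          ⟦ gs ⟧                              ≈⟨ ⟦⟧-coordinates gs ⟩
          ∑ᴹ (λ i → polyᵛ (d i) *ₗ ε i)       ∎)
        d-relation : ∑ᴹ (λ i → polyᵛ (d i) *ₗ x i) ≈ᴹ 0ᴹ
        d-relation = begin
          ∑ᴹ (λ i → polyᵛ (d i) *ₗ x i)       ≈⟨ ∑-cong {n} (λ i → ≈ᴹ-trans (*ₗ-congʳ (sym (pc≈d i))) (*ₗ-assoc _ _ _)) ⟩
          ∑ᴹ (λ i → poly p *ₗ (c i *ₗ x i))   ≈⟨ *ₗ-distrib-∑ {n} _ _ ⟨
          poly p *ₗ ∑ᴹ (λ i → c i *ₗ x i)     ≈⟨ *ₗ-congˡ relation ⟩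
          poly p *ₗ 0ᴹ                        ≈⟨ *ₗ-zeroʳ _ ⟩
          0ᴹ                                  ∎

      full⇒full : ∀ v → Q v
      full⇒full = spans⇒full (phiSubmodule⇒subspace V Q-sub)
                    (independent⇒spans (IsBasis.spanning ε-basis) x-independent) Qx

  irreducible-ascends : Irreducible W → Irreducible V
  irreducible-ascends irreducibleᵂ Q Q-sub
    with irreducibleᵂ (ConstantTerms.ConstantTerm Q-sub) (ConstantTerms.isPhiSubmodule Q-sub)
  ... | inj₁ trivial = inj₁ (ConstantTerms.trivial⇒trivial Q-sub trivial)
  ... | inj₂ full    = inj₂ (ConstantTerms.full⇒full Q-sub full)

lemma3p1 : ∀ {a : Level} → ExcludedMiddle a →
    (K : Field a) → CharZero K →
    (φ : Field.Carrier K → Field.Carrier K) → IsAutomorphism K φ →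
    (q : Field.Carrier K) → ¬ (Field._≈_ K q (Field.0# K)) → Field._≈_ K (φ q) q →
    (L : Field a) (ι : Field.Carrier K → Field.Carrier L) (z : Field.Carrier L) →
    IsPurelyTranscendental K L ι z →
    (φ′ : Field.Carrier L → Field.Carrier L) → IsAutomorphism L φ′ →
    (∀ c → Field._≈_ L (φ′ (ι c)) (ι (φ c))) →
    Field._≈_ L (φ′ z) (Field._*_ L (ι q) z) →
    (W : PhiModule K φ) (V : PhiModule L φ′)
    (j : Module.Carrierᴹ (PhiModule.space W) → Module.Carrierᴹ (PhiModule.space V)) →
    IsBaseChange {K = K} {L = L} ι (PhiModule.space W) (PhiModule.space V) j →
    (∀ w → Module._≈ᴹ_ (PhiModule.space V) (PhiModule.Φ V (j w)) (j (PhiModule.Φ W w))) →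
    Irreducible W ⇔ Irreducible V
lemma3p1 em K _ φ _ q _ _ L ι z purelyTranscendental φ′ φ′-aut φ′∘ι≈ι∘φ φ′z≈qz W V j baseChange Φ∘j≈j∘Φ =
  mk⇔ irreducible-ascends irreducible-descends
  where
  open BaseChange em K φ q L ι z purelyTranscendental φ′ φ′-aut φ′∘ι≈ι∘φ φ′z≈qz
                  W V j baseChange Φ∘j≈j∘Φ
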